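{- A positive integer $n$ is prime if and only if $T(n)=1+T(n-1)$.
   Context: For a vector $A=(a_1,\ldots,a_k)$, $k\geq 1$, of positive integers define $f(A)$ recursively by $f(a_1)=a_1$ and $f(a_1,\ldots,a_{i+1})=(f(a_1,\ldots,a_i)+1)\,a_{i+1}$. For a positive integer $n$, $T(n)$ is the number of vectors $A$ (of any length $k\geq1$, with positive integer entries) such that $f(A)=n$; also $T(0):=1$. -}

module Defs where

open import Data.Nat using (ℕ; zero; suc; _+_; _*_; _≟_)
open import Data.List using (List; []; _∷_; map; concatMap; length; filter; upTo)
open import Relation.Binary.PropositionalEquality using (_≡_)

-- f(a₁,…,a_k) for a vector given as head a₁ and tail (a₂,…,a_k):
-- f(a₁) = a₁,  f(a₁,…,a_{i+1}) = (f(a₁,…,a_i) + 1) · a_{i+1}.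
fAcc : ℕ → List ℕ → ℕ
fAcc acc []       = acc
fAcc acc (b ∷ bs) = fAcc ((acc + 1) * b) bs

f : List ℕ → ℕ
f []       = 0          -- never used: vectors have length k ≥ 1
f (a ∷ as) = fAcc a as

range1 : ℕ → List ℕ
range1 n = map suc (upTo n)

listsOf : ℕ → ℕ → List (List ℕ)
listsOf n zero    = [] ∷ []
listsOf n (suc k) = concatMap (λ a → map (a ∷_) (listsOf n k)) (range1 n)

-- Every vector A of positive integers with f(A) = n lies in this list:
-- each entry a_i ≤ f(a₁,…,a_i) ≤ n, and f strictly increases along
-- prefixes, so the length is ≤ n.
candidates : ℕ → List (List ℕ)
candidates n = concatMap (λ k → listsOf n (suc k)) (upTo n)

T : ℕ → ℕ
T zero    = 1
T (suc n) = length (filter (λ A → f A ≟ suc n) (candidates (suc n)))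

{-# OPTIONS --safe #-}
module Submission where

-- Appending an entry 1 sends each solution of f(A) = n − 1 to a solution of f(A) = n, and
-- none of these images is the one-entry solution (n); hence T(n) ≥ 1 + T(n − 1). Every other
-- solution has the form (B, b) with b ≠ 1, and f(B, b) = (f(B) + 1) · b with f(B) ≥ 1 is then a
-- factorisation of n with both factors > 1, which a prime does not have. Conversely a proper
-- factorisation n = d · q yields the extra solution (d − 1, q).

open import Defs
open import Data.Nat using (ℕ; zero; suc; _+_; _*_; _≤_; _<_; _∸_; _≟_; z≤n; s≤s)
open import Data.Nat.Properties
open import Data.Nat.Divisibility using (divides; quotient; quotient>1; m∣n⇒n≡quotient*m)
open import Data.Nat.Primality
  using (Prime; Composite; composite; prime⇒irreducible; prime⇒nonZero; ¬prime[1]; ¬composite⇒prime)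
open import Data.List
  using (List; []; _∷_; [_]; _++_; _∷ʳ_; length; map; concatMap; cartesianProductWith; upTo; filter;
         initLast; _∷ʳ′_)
open import Data.List.Properties
  using (∷-injective; ∷ʳ-injectiveˡ; ∷ʳ-injectiveʳ; length-map; length-removeAt′)
open import Data.List.Membership.Propositional using (_∈_; _∉_; lose; find)
open import Data.List.Membership.Propositional.Properties
open import Data.List.Relation.Binary.Subset.Propositional using (_⊆_)
open import Data.List.Relation.Binary.Disjoint.Propositional using (Disjoint)
open import Data.List.Relation.Unary.Any using (here; there; _─_; index)
open import Data.List.Relation.Unary.All as All using (All; []; _∷_)
import Data.List.Relation.Unary.All.Properties as All
open import Data.List.Relation.Unary.AllPairs as AllPairs using ([]; _∷_)
import Data.List.Relation.Unary.AllPairs.Properties as AllPairs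
open import Data.List.Relation.Unary.Unique.Propositional using (Unique)
import Data.List.Relation.Unary.Unique.Propositional.Properties as Unique
open import Data.Product using (_×_; _,_; proj₁; proj₂; ∃-syntax)
open import Data.Sum using (inj₁; inj₂)
open import Function.Bundles using (_⇔_; mk⇔)
open import Relation.Binary.PropositionalEquality
  using (_≡_; _≢_; refl; sym; trans; cong; subst; module ≡-Reasoning)
open import Relation.Nullary using (contradiction)

module _ {a} {A : Set a} where

  ∈-─⁺ : ∀ {x y} {xs : List A} (x∈xs : x ∈ xs) → y ∈ xs → y ≢ x → y ∈ (xs ─ x∈xs)
  ∈-─⁺ (here refl)  (here refl)  y≢x = contradiction refl y≢x
  ∈-─⁺ (here refl)  (there y∈xs) _   = y∈xs
  ∈-─⁺ (there _)    (here refl)  _   = here refl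
  ∈-─⁺ (there x∈xs) (there y∈xs) y≢x = there (∈-─⁺ x∈xs y∈xs y≢x)

  Unique-⊆⇒length≤ : ∀ {xs ys : List A} → Unique xs → xs ⊆ ys → length xs ≤ length ys
  Unique-⊆⇒length≤ {[]}     _             _     = z≤n
  Unique-⊆⇒length≤ {x ∷ xs} {ys} (x∉xs ∷ xs!) xs⊆ys = begin
    suc (length xs)          ≤⟨ s≤s (Unique-⊆⇒length≤ xs! xs⊆ys─x∈ys) ⟩
    suc (length (ys ─ x∈ys)) ≡⟨ length-removeAt′ ys (index x∈ys) ⟨
    length ys                ∎
    where
    open ≤-Reasoning
    x∈ys : x ∈ ys
    x∈ys = xs⊆ys (here refl)
    xs⊆ys─x∈ys : xs ⊆ (ys ─ x∈ys)
    xs⊆ys─x∈ys y∈xs = ∈-─⁺ x∈ys (xs⊆ys (there y∈xs)) (λ y≡x → All.lookup x∉xs y∈xs (sym y≡x))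

  Unique-⊆-∉⇒length< : ∀ {xs ys : List A} {y} →
                       Unique xs → xs ⊆ ys → y ∈ ys → y ∉ xs → length xs < length ys
  Unique-⊆-∉⇒length< {xs} xs! xs⊆ys y∈ys y∉xs =
    Unique-⊆⇒length≤ (All.¬Any⇒All¬ xs y∉xs ∷ xs!)
      λ { (here refl) → y∈ys ; (there x∈xs) → xs⊆ys x∈xs }

  ∷ʳ-∉-map-∷ʳ : ∀ {x y} xs (xss : List (List A)) → x ≢ y → xs ∷ʳ x ∉ map (_∷ʳ y) xss
  ∷ʳ-∉-map-∷ʳ xs xss x≢y xs∷ʳx∈ with ys , _ , eq ← ∈-map⁻ _ xs∷ʳx∈ = x≢y (∷ʳ-injectiveʳ xs ys eq)

concatMap-map≡cartesianProductWith : ∀ {a b c} {A : Set a} {B : Set b} {C : Set c}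
  (g : A → B → C) (xs : List A) (ys : List B) →
  concatMap (λ x → map (g x) ys) xs ≡ cartesianProductWith g xs ys
concatMap-map≡cartesianProductWith g []       ys = refl
concatMap-map≡cartesianProductWith g (x ∷ xs) ys =
  cong (map (g x) ys ++_) (concatMap-map≡cartesianProductWith g xs ys)

listsOf-suc : ∀ n k → listsOf n (suc k) ≡ cartesianProductWith _∷_ (range1 n) (listsOf n k)
listsOf-suc n k = concatMap-map≡cartesianProductWith _∷_ (range1 n) (listsOf n k)

∈-range1⁺ : ∀ {n a} → 1 ≤ a → a ≤ n → a ∈ range1 n
∈-range1⁺ {a = suc a} _ a<n = ∈-map⁺ suc (∈-upTo⁺ a<n)

∈-range1⁻ : ∀ {n a} → a ∈ range1 n → 1 ≤ a × a ≤ n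
∈-range1⁻ a∈ with _ , b∈ , refl ← ∈-map⁻ suc a∈ = s≤s z≤n , ∈-upTo⁻ b∈

∈-listsOf⁺ : ∀ n {xs} → All (_∈ range1 n) xs → xs ∈ listsOf n (length xs)
∈-listsOf⁺ n []                 = here refl
∈-listsOf⁺ n {x ∷ xs} (x∈ ∷ xs∈) =
  subst (x ∷ xs ∈_) (sym (listsOf-suc n (length xs)))
    (∈-cartesianProductWith⁺ _∷_ x∈ (∈-listsOf⁺ n xs∈))

∈-listsOf⁻ : ∀ n k {xs} → xs ∈ listsOf n k → length xs ≡ k × All (_∈ range1 n) xs
∈-listsOf⁻ n zero    (here refl) = refl , []
∈-listsOf⁻ n (suc k) xs∈
  with x , ys , x∈ , ys∈ , refl ← ∈-cartesianProductWith⁻ _∷_ (range1 n) (listsOf n k)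
                                    (subst (_ ∈_) (listsOf-suc n k) xs∈)
  with len , ys⊆ ← ∈-listsOf⁻ n k ys∈ = cong suc len , x∈ ∷ ys⊆

Unique-listsOf : ∀ n k → Unique (listsOf n k)
Unique-listsOf n zero    = [] ∷ []
Unique-listsOf n (suc k) = subst Unique (sym (listsOf-suc n k))
  (Unique.cartesianProductWith⁺ _∷_ ∷-injective
    (Unique.map⁺ suc-injective (Unique.upTo⁺ n)) (Unique-listsOf n k))

∈-candidates⁺ : ∀ n {xs} → 1 ≤ length xs → length xs ≤ n → All (_∈ range1 n) xs →
                xs ∈ candidates n
∈-candidates⁺ n {x ∷ xs} _ len≤n xs⊆ =
  ∈-concatMap⁺ (λ k → listsOf n (suc k)) (lose (∈-upTo⁺ len≤n) (∈-listsOf⁺ n xs⊆))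

∈-candidates⁻ : ∀ n {xs} → xs ∈ candidates n → All (_∈ range1 n) xs
∈-candidates⁻ n xs∈
  with k , _ , xs∈′ ← find (∈-concatMap⁻ (λ k → listsOf n (suc k)) {xs = upTo n} xs∈) = proj₂ (∈-listsOf⁻ n (suc k) xs∈′)

Unique-candidates : ∀ n → Unique (candidates n)
Unique-candidates n = Unique.concat⁺
  (All.map⁺ (All.universal (λ k → Unique-listsOf n (suc k)) (upTo n)))
  (AllPairs.map⁺ (AllPairs.map disjoint (Unique.upTo⁺ n)))
  where
  disjoint : ∀ {k l} → k ≢ l → Disjoint (listsOf n (suc k)) (listsOf n (suc l))
  disjoint k≢l (xs∈ , xs∈′) =
    k≢l (suc-injective (trans (sym (proj₁ (∈-listsOf⁻ n _ xs∈))) (proj₁ (∈-listsOf⁻ n _ xs∈′))))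

fAcc-∷ʳ : ∀ acc bs b → fAcc acc (bs ∷ʳ b) ≡ (fAcc acc bs + 1) * b
fAcc-∷ʳ acc []       b = refl
fAcc-∷ʳ acc (c ∷ bs) b = fAcc-∷ʳ ((acc + 1) * c) bs b

f-∷ʳ : ∀ A b → f (A ∷ʳ b) ≡ (f A + 1) * b
f-∷ʳ []       b = sym (+-identityʳ b)
f-∷ʳ (a ∷ as) b = fAcc-∷ʳ a as b

acc+length≤fAcc : ∀ acc {bs} → All (1 ≤_) bs → acc + length bs ≤ fAcc acc bs
acc+length≤fAcc acc {[]}     []           = ≤-reflexive (+-identityʳ acc)
acc+length≤fAcc acc {b ∷ bs} (s≤s z≤n ∷ 1≤bs) = begin
  acc + suc (length bs)     ≡⟨ +-suc acc (length bs) ⟩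
  suc acc + length bs       ≡⟨ cong (_+ length bs) (+-comm 1 acc) ⟩
  acc + 1 + length bs       ≤⟨ +-monoˡ-≤ (length bs) (m≤m*n (acc + 1) b) ⟩
  (acc + 1) * b + length bs ≤⟨ acc+length≤fAcc ((acc + 1) * b) 1≤bs ⟩
  fAcc ((acc + 1) * b) bs   ∎
  where open ≤-Reasoning

acc≤fAcc : ∀ acc {bs} → All (1 ≤_) bs → acc ≤ fAcc acc bs
acc≤fAcc acc 1≤bs = ≤-trans (m≤m+n acc _) (acc+length≤fAcc acc 1≤bs)

All-≤-fAcc : ∀ acc {bs} → All (1 ≤_) bs → All (_≤ fAcc acc bs) bs
All-≤-fAcc acc []                       = []
All-≤-fAcc acc {b ∷ bs} (_ ∷ 1≤bs) =
  ≤-trans b≤[acc+1]*b (acc≤fAcc _ 1≤bs) ∷ All-≤-fAcc _ 1≤bs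
  where
  b≤[acc+1]*b : b ≤ (acc + 1) * b
  b≤[acc+1]*b = subst (_≤ (acc + 1) * b) (+-identityʳ b) (*-monoˡ-≤ b (m≤n+m 1 acc))

length≤f : ∀ {A} → All (1 ≤_) A → length A ≤ f A
length≤f {[]}     []           = z≤n
length≤f {a ∷ as} (1≤a ∷ 1≤as) = ≤-trans (+-monoˡ-≤ (length as) 1≤a) (acc+length≤fAcc a 1≤as)

All-≤-f : ∀ {A} → All (1 ≤_) A → All (_≤ f A) A
All-≤-f {[]}     []           = []
All-≤-f {a ∷ as} (1≤a ∷ 1≤as) = acc≤fAcc a 1≤as ∷ All-≤-fAcc a 1≤as

1≤f : ∀ {a as} → All (1 ≤_) (a ∷ as) → 1 ≤ f (a ∷ as)
1≤f 1≤A = ≤-trans (s≤s z≤n) (length≤f 1≤A)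

solutions : ℕ → List (List ℕ)
solutions n = filter (λ A → f A ≟ n) (candidates n)

Unique-solutions : ∀ n → Unique (solutions n)
Unique-solutions n = Unique.filter⁺ (λ A → f A ≟ n) (Unique-candidates n)

-- The hypothesis 1 ≤ f A only excludes A = [], the junk case f [] = 0.
∈-solutions⁺ : ∀ {A} → All (1 ≤_) A → 1 ≤ f A → A ∈ solutions (f A)
∈-solutions⁺ {a ∷ as} 1≤A _ = ∈-filter⁺ (λ A → f A ≟ f (a ∷ as))
  (∈-candidates⁺ _ (s≤s z≤n) (length≤f 1≤A)
    (All.zipWith (λ (1≤x , x≤f) → ∈-range1⁺ 1≤x x≤f) (1≤A , All-≤-f 1≤A)))
  refl

∈-solutions⁻ : ∀ n {A} → A ∈ solutions n → All (1 ≤_) A × f A ≡ n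
∈-solutions⁻ n A∈ with A∈cands , fA≡n ← ∈-filter⁻ (λ A → f A ≟ n) A∈ =
  All.map (λ x∈ → proj₁ (∈-range1⁻ x∈)) (∈-candidates⁻ n A∈cands) , fA≡n

∷ʳ-1-∈-solutions : ∀ n {A} → A ∈ solutions n → A ∷ʳ 1 ∈ solutions (suc n)
∷ʳ-1-∈-solutions n {A} A∈ =
  subst (λ m → A ∷ʳ 1 ∈ solutions m) f[A∷ʳ1]≡1+n
    (∈-solutions⁺ (All.∷ʳ⁺ (proj₁ (∈-solutions⁻ n A∈)) ≤-refl)
                  (subst (1 ≤_) (sym f[A∷ʳ1]≡1+n) (s≤s z≤n)))
  where
  f[A∷ʳ1]≡1+n : f (A ∷ʳ 1) ≡ suc n
  f[A∷ʳ1]≡1+n = begin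
    f (A ∷ʳ 1)      ≡⟨ f-∷ʳ A 1 ⟩
    (f A + 1) * 1   ≡⟨ *-identityʳ _ ⟩
    f A + 1         ≡⟨ +-comm (f A) 1 ⟩
    suc (f A)       ≡⟨ cong suc (proj₂ (∈-solutions⁻ n A∈)) ⟩
    suc n           ∎
    where open ≡-Reasoning

obviousSolutions : ℕ → List (List ℕ)
obviousSolutions n = [ suc n ] ∷ map (_∷ʳ 1) (solutions n)

length-obviousSolutions : ∀ n → length (obviousSolutions n) ≡ suc (length (solutions n))
length-obviousSolutions n = cong suc (length-map (_∷ʳ 1) (solutions n))

obviousSolutions⊆solutions : ∀ n → obviousSolutions n ⊆ solutions (suc n)
obviousSolutions⊆solutions n (here refl) = ∈-solutions⁺ (s≤s z≤n ∷ []) (s≤s z≤n)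
obviousSolutions⊆solutions n (there A∈)
  with _ , B∈ , refl ← ∈-map⁻ (_∷ʳ 1) A∈ = ∷ʳ-1-∈-solutions n B∈

Unique-obviousSolutions : ∀ n → Unique (obviousSolutions (suc n))
Unique-obviousSolutions n =
  All.¬Any⇒All¬ _ (∷ʳ-∉-map-∷ʳ [] (solutions (suc n)) λ ())
    ∷ Unique.map⁺ (λ {xs} {ys} → ∷ʳ-injectiveˡ xs ys) (Unique-solutions (suc n))

m*n≡p⇒m≡p∧n≡1 : ∀ {m n p} → Prime p → 1 < m → m * n ≡ p → m ≡ p × n ≡ 1
m*n≡p⇒m≡p∧n≡1 {m} {n} p-prime 1<m m*n≡p
  with prime⇒irreducible p-prime (divides n (sym (trans (*-comm n m) m*n≡p)))
... | inj₁ m≡1 = contradiction m≡1 (>⇒≢ 1<m)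
... | inj₂ refl =
  refl , *-cancelˡ-≡ n 1 m {{prime⇒nonZero p-prime}} (trans m*n≡p (sym (*-identityʳ m)))

solutions⊆obviousSolutions : ∀ {n} → Prime (suc n) → solutions (suc n) ⊆ obviousSolutions n
solutions⊆obviousSolutions {n} p-prime {A} A∈ with ∈-solutions⁻ (suc n) A∈ | initLast A
... | _   , ()   | []
... | _   , refl | [] ∷ʳ′ b = here refl
... | 1≤A , fA≡  | (a ∷ as) ∷ʳ′ b
  with 1≤B , _ ← All.∷ʳ⁻ 1≤A
  with 1+fB≡1+n , refl ← m*n≡p⇒m≡p∧n≡1 p-prime (+-monoˡ-≤ 1 (1≤f 1≤B))
                            (trans (sym (f-∷ʳ (a ∷ as) b)) fA≡) =
  there (∈-map⁺ (_∷ʳ 1) (subst (λ m → a ∷ as ∈ solutions m) fB≡n (∈-solutions⁺ 1≤B (1≤f 1≤B))))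
  where
  fB≡n : f (a ∷ as) ≡ n
  fB≡n = +-cancelʳ-≡ _ _ _ (trans 1+fB≡1+n (+-comm 1 n))

composite⇒solution∉obviousSolutions : ∀ {n} → Composite (suc n) →
  ∃[ A ] A ∈ solutions (suc n) × A ∉ obviousSolutions n
composite⇒solution∉obviousSolutions {n} (composite {suc (suc e)} d<N d∣N) = A , A∈ , A∉
  where
  q = quotient d∣N
  1<q : 1 < q
  1<q = quotient>1 d∣N d<N
  A : List ℕ
  A = suc e ∷ q ∷ []
  fA≡1+n : f A ≡ suc n
  fA≡1+n = begin
    (suc e + 1) * q   ≡⟨ cong (_* q) (+-comm (suc e) 1) ⟩
    suc (suc e) * q   ≡⟨ *-comm (suc (suc e)) q ⟩
    q * suc (suc e)   ≡⟨ m∣n⇒n≡quotient*m d∣N ⟨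
    suc n             ∎
    where open ≡-Reasoning
  A∈ : A ∈ solutions (suc n)
  A∈ = subst (λ m → A ∈ solutions m) fA≡1+n
    (∈-solutions⁺ (s≤s z≤n ∷ <⇒≤ 1<q ∷ []) (subst (1 ≤_) (sym fA≡1+n) (s≤s z≤n)))
  A∉ : A ∉ obviousSolutions n
  A∉ (here ())
  A∉ (there A∈′) = ∷ʳ-∉-map-∷ʳ (suc e ∷ []) (solutions n) (>⇒≢ 1<q) A∈′

T-lowerBound : ∀ n → suc (T (suc n)) ≤ T (suc (suc n))
T-lowerBound n = subst (_≤ T (suc (suc n))) (length-obviousSolutions (suc n))
  (Unique-⊆⇒length≤ (Unique-obviousSolutions n) (obviousSolutions⊆solutions (suc n)))

T-upperBound-prime : ∀ n → Prime (suc (suc n)) → T (suc (suc n)) ≤ suc (T (suc n))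
T-upperBound-prime n p-prime = subst (T (suc (suc n)) ≤_) (length-obviousSolutions (suc n))
  (Unique-⊆⇒length≤ (Unique-solutions (suc (suc n))) (solutions⊆obviousSolutions p-prime))

T-lowerBound-composite : ∀ n → Composite (suc (suc n)) → suc (T (suc n)) < T (suc (suc n))
T-lowerBound-composite n n-composite
  with A , A∈ , A∉ ← composite⇒solution∉obviousSolutions n-composite =
  subst (_< T (suc (suc n))) (length-obviousSolutions (suc n))
    (Unique-⊆-∉⇒length< (Unique-obviousSolutions n) (obviousSolutions⊆solutions (suc n)) A∈ A∉)

corollary1 : (n : ℕ) → 1 ≤ n → (Prime n ⇔ T n ≡ suc (T (n ∸ 1)))
corollary1 (suc zero)    _ = mk⇔ (λ 1-prime → contradiction 1-prime ¬prime[1]) (λ ())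
corollary1 (suc (suc n)) _ = mk⇔
  (λ p-prime → ≤-antisym (T-upperBound-prime n p-prime) (T-lowerBound n))
  (λ T≡ → ¬composite⇒prime (λ n-composite → <⇒≢ (T-lowerBound-composite n n-composite) (sym T≡)))
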